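{- Let $A,B\in\mathbb Z^{d\times d}$ be nonsingular and let $N_0\in\mathrm{PH}(B)$. Let $\mathfrak S_d=\bigsqcup_{i=1}^\ell\mathrm G(N_0)g_i$ be a right coset decomposition with respect to $\mathrm G(N_0)$. Then $A\simeq_{\mathrm{UP}}B$ $\iff$ $\mathrm H(A\cdot g_i^{ -1})\in\mathrm O(N_0)$ for some $i\in\{1,\dots,\ell\}$ $\iff$ for some $i\in\{1,\dots,\ell\}$, $\mathrm G(\mathrm H(A\cdot g_i^{ -1}))=\mathrm G(N_0)$ and $\min\mathrm O(\mathrm H(A\cdot g_i^{ -1}))=N_0$ (minimum with respect to $\le_{\mathrm{rblex}}$).
   Context: $\mathrm H(M)$ is the Hermite normal form of nonsingular $M\in\mathbb Z^{d\times d}$ (unique $UM$, $U\in\mathrm{GL}_d(\mathbb Z)$, upper triangular with positive diagonal and off-diagonal entries nonnegative and strictly smaller than the diagonal entry of their column). For $\sigma\in\mathfrak S_d$, $P_\sigma=(\mathbf e_{\sigma(1)}|\cdots|\mathbf e_{\sigma(d)})$, $M\cdot\sigma=MP_\sigma$; $A\simeq_{\mathrm{UP}}B$ means $UA=B\cdot\sigma$ for some $U\in\mathrm{GL}_d(\mathbb Z)$, $\sigma\in\mathfrak S_d$. For $\mathbf r=(r_1<\dots<r_s)$ and $\mathbf m=(m_1,\dots,m_s)$ positive integers with $\sum m_i=d$, $\mathcal M(\mathbf r,\mathbf m)$ is the set of block upper-triangular integer matrices with diagonal blocks $r_iI_{m_i}$, zero blocks below, arbitrary blocks above. For $N\in\mathcal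 M(\mathbf r,\mathbf m)$, with $w_i=\{m_1+\dots+m_{i-1}+1,\dots,m_1+\dots+m_i\}$, the pattern group is $\mathrm G(N)=\mathfrak S_{w_1}\times\cdots\times\mathfrak S_{w_{s-1}}\le\mathfrak S_d$ and the orbit is $\mathrm O(N)=\{P_gNP_g^{ -1}:g\in\mathrm G(N)\}$. For equal-size matrices, $X<_{\mathrm{rlex}}Y$ if at the first differing entry (rows top to bottom, within a row right to left) $X$'s entry is smaller. On $\mathcal M(\mathbf r,\mathbf m)$, $M<_{\mathrm{rblex}}M'$ if there is $k\in\{s-1,\dots,1\}$ such that the rows indexed by $w_l$ coincide for all $k<l\le s-1$ and the submatrix of rows indexed by $w_k$ of $M$ is $<_{\mathrm{rlex}}$ that of $M'$. $\mathrm{PH}(B)$ is the set of $N_0=\mathrm H(B\cdot g)$, $g\in\mathfrak S_d$, with $N_0\in\mathcal M(\mathbf r,\mathbf m)$ for some $\mathbf r,\mathbf m$, whose first positive entry in each row is $\le$ every other positive entry of that row, and which is the $\le_{\mathrm{rblex}}$-minimum of $\mathrm O(N_0)$. -}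

module Defs where

open import Data.Nat as ℕ using (ℕ; zero; suc)
open import Data.Integer as ℤ using (ℤ; +_; 0ℤ; 1ℤ; -1ℤ)
open import Data.Fin using (Fin; toℕ; punchIn)
open import Data.Fin.Permutation using (Permutation′; _⟨$⟩ʳ_; _⟨$⟩ˡ_)
open import Data.List using (map; allFin)
open import Data.Nat.ListAction using (sum)
open import Relation.Nullary using (Dec)
open import Data.Product using (Σ; ∃; ∃-syntax; _×_; _,_)
open import Data.Sum using (_⊎_)
open import Relation.Binary.PropositionalEquality using (_≡_; _≢_)
open import Relation.Nullary using (¬_; yes; no)
open import Function.Bundles using (_⇔_)

Mat : ℕ → Set
Mat d = Fin d → Fin d → ℤ

∑ : ∀ {n} → (Fin n → ℤ) → ℤ
∑ {zero}  f = 0ℤ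
∑ {suc n} f = f Fin.zero ℤ.+ ∑ (λ i → f (Fin.suc i))
  where import Data.Fin as Fin

infixl 7 _⊗_
_⊗_ : ∀ {d} → Mat d → Mat d → Mat d
(M ⊗ N) i j = ∑ (λ k → M i k ℤ.* N k j)

infix 4 _≈_
_≈_ : ∀ {d} → Mat d → Mat d → Set
M ≈ N = ∀ i j → M i j ≡ N i j

Id : ∀ {d} → Mat d
Id i j with i Data.Fin.≟ j
... | yes _ = 1ℤ
... | no  _ = 0ℤ
  where import Data.Fin

det : ∀ {n} → Mat n → ℤ
det {zero}  M = 1ℤ
det {suc n} M = ∑ (λ j → (-1ℤ ℤ.^ toℕ j) ℤ.* M Fin.zero j ℤ.* det (λ a b → M (Fin.suc a) (punchIn j b)))
  where import Data.Fin as Fin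

Nonsingular : ∀ {d} → Mat d → Set
Nonsingular M = det M ≢ 0ℤ

GL : ∀ {d} → Mat d → Set
GL {d} U = Σ (Mat d) λ V → (U ⊗ V ≈ Id) × (V ⊗ U ≈ Id)

-- Permutations: σ ⟨$⟩ʳ i is σ(i), σ ⟨$⟩ˡ i is σ⁻¹(i)

Perm : ℕ → Set
Perm d = Permutation′ d

-- P_σ = (e_σ(1) | ... | e_σ(d)) : column j is e_{σ(j)}
Pmat : ∀ {d} → Perm d → Mat d
Pmat σ i j = Id i (σ ⟨$⟩ʳ j)

PmatInv : ∀ {d} → Perm d → Mat d
PmatInv σ i j = Id i (σ ⟨$⟩ˡ j)

_·_ : ∀ {d} → Mat d → Perm d → Mat d
M · σ = M ⊗ Pmat σ

_·⁻¹_ : ∀ {d} → Mat d → Perm d → Mat d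
M ·⁻¹ σ = M ⊗ PmatInv σ

IsHNF : ∀ {d} → Mat d → Set
IsHNF N = ∀ i j →
  (toℕ j ℕ.< toℕ i → N i j ≡ 0ℤ) ×
  (i ≡ j → 0ℤ ℤ.< N i j) ×
  (toℕ i ℕ.< toℕ j → (0ℤ ℤ.≤ N i j) × (N i j ℤ.< N j j))

IsHNFOf : ∀ {d} → Mat d → Mat d → Set
IsHNFOf M N = IsHNF N × Σ (Mat _) λ U → GL U × (U ⊗ M ≈ N)

_≃UP_ : ∀ {d} → Mat d → Mat d → Set
A ≃UP B = Σ (Mat _) λ U → Σ (Perm _) λ σ → GL U × (U ⊗ A ≈ B · σ)

when : ∀ {P : Set} → Dec P → ℕ → ℕ
when (yes _) x = x
when (no _)  x = 0

record BS (d : ℕ) : Set where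
  field
    s     : ℕ
    r     : Fin s → ℕ
    m     : Fin s → ℕ
    r-pos : ∀ i → 0 ℕ.< r i
    r-inc : ∀ i j → toℕ i ℕ.< toℕ j → r i ℕ.< r j
    m-pos : ∀ i → 0 ℕ.< m i
    m-sum : sum (map m (allFin s)) ≡ d

  pre : ℕ → ℕ
  pre k = sum (map (λ i → when (toℕ i ℕ.<? k) (m i)) (allFin s))

  -- index j (0-based) lies in w_{i} (block i, 0-based)
  InBlock : Fin d → Fin s → Set
  InBlock j i = (pre (toℕ i) ℕ.≤ toℕ j) × (toℕ j ℕ.< pre (suc (toℕ i)))

open BS public

module _ {d : ℕ} (bs : BS d) where
  private
    S = s bs

  InM : Mat d → Set
  InM N = ∀ i j bi bj → InBlock bs i bi → InBlock bs j bj →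
    (bi ≡ bj → i ≡ j → N i j ≡ + r bs bi) ×
    (bi ≡ bj → i ≢ j → N i j ≡ 0ℤ) ×
    (toℕ bj ℕ.< toℕ bi → N i j ≡ 0ℤ)

  -- pattern group G = S_{w_1} × ... × S_{w_{s-1}} (fixes w_s pointwise)
  Gp : Perm d → Set
  Gp σ = ∀ j bj → InBlock bs j bj →
    (suc (toℕ bj) ℕ.< S → InBlock bs (σ ⟨$⟩ʳ j) bj) ×
    (suc (toℕ bj) ≡ S → σ ⟨$⟩ʳ j ≡ j)

  Orb : Mat d → Mat d → Set
  Orb N X = Σ (Perm d) λ g → Gp g × (X ≈ Pmat g ⊗ N ⊗ PmatInv g)

  -- reverse-lexicographic comparison restricted to rows satisfying R
  -- (rows top to bottom, within a row right to left)
  RLex< : (Fin d → Set) → Mat d → Mat d → Set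
  RLex< R X Y = Σ (Fin d) λ i → Σ (Fin d) λ j → R i × (X i j ℤ.< Y i j) ×
    (∀ i′ j′ → R i′ → (toℕ i′ ℕ.< toℕ i ⊎ (i′ ≡ i × toℕ j ℕ.< toℕ j′)) → X i′ j′ ≡ Y i′ j′)

  -- <_rblex on M(r, m); k ranges over blocks 1..s-1 (0-based: toℕ k + 1 < s)
  _<rblex_ : Mat d → Mat d → Set
  X <rblex Y = Σ (Fin S) λ k → (suc (toℕ k) ℕ.< S) ×
    (∀ l → toℕ k ℕ.< toℕ l → suc (toℕ l) ℕ.< S → ∀ i → InBlock bs i l → ∀ j → X i j ≡ Y i j) ×
    RLex< (λ i → InBlock bs i k) X Y

  _≤rblex_ : Mat d → Mat d → Set
  X ≤rblex Y = X <rblex Y ⊎ X ≈ Y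

  IsMinOrb : Mat d → Mat d → Set
  IsMinOrb N N₀ = Orb N N₀ × (∀ X → Orb N X → N₀ ≤rblex X)

-- Notions attached to a matrix N (its block data (r,m) is unique when it exists)

GOf : ∀ {d} → Mat d → Perm d → Set
GOf N σ = Σ (BS _) λ bs → InM bs N × Gp bs σ

OOf : ∀ {d} → Mat d → Mat d → Set
OOf N X = Σ (BS _) λ bs → InM bs N × Orb bs N X

MinOOf : ∀ {d} → Mat d → Mat d → Set
MinOOf N N₀ = Σ (BS _) λ bs → InM bs N × IsMinOrb bs N N₀

FirstPosMin : ∀ {d} → Mat d → Set
FirstPosMin N = ∀ i → Σ (Fin _) λ j → (0ℤ ℤ.< N i j) ×
  (∀ j′ → toℕ j′ ℕ.< toℕ j → N i j′ ℤ.≤ 0ℤ) ×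
  (∀ j′ → 0ℤ ℤ.< N i j′ → N i j ℤ.≤ N i j′)

InPH : ∀ {d} → Mat d → Mat d → Set
InPH B N₀ = (Σ (Perm _) λ g → IsHNFOf (B · g) N₀) ×
  (Σ (BS _) λ bs → InM bs N₀ × FirstPosMin N₀ × IsMinOrb bs N₀ N₀)

RightCosetDecomp : ∀ {d ℓ} → (Perm d → Set) → (Fin ℓ → Perm d) → Set
RightCosetDecomp {d} G g =
  (∀ σ → Σ (Fin _) λ i → Σ (Perm d) λ h → G h × (∀ x → σ ⟨$⟩ʳ x ≡ h ⟨$⟩ʳ (g i ⟨$⟩ʳ x))) ×
  (∀ i j (h h′ : Perm d) → G h → G h′ →
      (∀ x → h ⟨$⟩ʳ (g i ⟨$⟩ʳ x) ≡ h′ ⟨$⟩ʳ (g j ⟨$⟩ʳ x)) → i ≡ j)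

{-# OPTIONS --safe #-}
-- Write X ∼ Y when U X = Y for some U ∈ GL_d(ℤ). Left multiplication commutes with permuting
-- columns, and permuting rows is itself a left multiplication. So if σ = g₀ h gᵢ, where B·g₀ ∼ N₀,
-- then A ∼ B·σ iff A·gᵢ⁻¹ ∼ (B·g₀)·h ∼ N₀·h ∼ P_h⁻¹ N₀ P_h. For h ∈ G(N₀) the matrix P_h⁻¹ N₀ P_h
-- is again a Hermite normal form and lies in O(N₀), because h only permutes indices inside the
-- scalar diagonal blocks of N₀. The coset decomposition provides such a factorisation of every σ.
-- For the second equivalence: for N ∈ M(r, m) the group G(N) depends only on the diagonal of N,
-- which is constant on orbits, and the orbits are the classes of an equivalence relation. So
-- O(H) = O(N₀), and its minimum is N₀.
module Submission where

open import Defs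
open import Data.Nat using (ℕ)
open import Data.Fin using (Fin)
open import Data.Product using (Σ; _×_)
open import Function.Bundles using (_⇔_)

open import Data.Nat as ℕ using (zero; suc; _≤_; _<_; z≤n)
import Data.Nat.Properties as ℕ
open import Data.Integer as ℤ using (ℤ; +_; 0ℤ; 1ℤ; _+_; _*_)
import Data.Integer.Properties as ℤ
open import Data.Fin as Fin using (toℕ; fromℕ; fromℕ<)
import Data.Fin.Properties as Fin
open import Data.Fin.Permutation using (_⟨$⟩ʳ_; _⟨$⟩ˡ_; inverseˡ; inverseʳ; flip; _∘ₚ_)
open import Data.Product using (_,_; proj₁; proj₂)
open import Data.Sum using (inj₁; inj₂)
open import Data.List using ([]; _∷_; map; allFin)
open import Data.List.Membership.Propositional using (_∈_)
open import Data.List.Membership.Propositional.Properties using (∈-allFin)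
open import Data.List.Properties using (map-cong)
open import Data.List.Relation.Unary.Any using (here; there)
open import Data.Nat.ListAction using (sum)
open import Relation.Binary.Definitions using (tri<; tri≈; tri>)
open import Function.Base using (_∘_)
open import Function.Bundles using (mk⇔; Equivalence)
open import Relation.Binary.Bundles using (Setoid)
open import Relation.Binary.PropositionalEquality
open import Relation.Nullary using (yes; no; contradiction)
import Algebra.Properties.Semiring.Sum as SemiringSum
import Relation.Binary.Reasoning.Setoid as SetoidReasoning

module ℤ∑ = SemiringSum ℤ.+-*-semiring

∑≡sum : ∀ {n} (f : Fin n → ℤ) → ∑ f ≡ ℤ∑.sum f
∑≡sum {zero}  f = refl
∑≡sum {suc n} f = cong (_+_ (f Fin.zero)) (∑≡sum (f ∘ Fin.suc))

∑-cong : ∀ {n} {f g : Fin n → ℤ} → (∀ k → f k ≡ g k) → ∑ f ≡ ∑ g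
∑-cong {f = f} {g} f≗g = begin
  ∑ f       ≡⟨ ∑≡sum f ⟩
  ℤ∑.sum f  ≡⟨ ℤ∑.sum-cong-≗ f≗g ⟩
  ℤ∑.sum g  ≡⟨ ∑≡sum g ⟨
  ∑ g       ∎
  where open ≡-Reasoning

∑-zero : ∀ n → ∑ {n} (λ _ → 0ℤ) ≡ 0ℤ
∑-zero n = trans (∑≡sum {n} _) (ℤ∑.sum-replicate-zero n)

Id-suc : ∀ {d} (i j : Fin d) → Id (Fin.suc i) (Fin.suc j) ≡ Id i j
Id-suc i j with i Fin.≟ j
... | yes _ = refl
... | no  _ = refl

Id-sym : ∀ {d} (i j : Fin d) → Id i j ≡ Id j i
Id-sym i j with i Fin.≟ j | j Fin.≟ i
... | yes _   | yes _   = refl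
... | no  _   | no  _   = refl
... | yes i≡j | no  j≢i = contradiction (sym i≡j) j≢i
... | no  i≢j | yes j≡i = contradiction (sym j≡i) i≢j

∑-δʳ : ∀ {n} (f : Fin n → ℤ) a → ∑ (λ k → f k * Id k a) ≡ f a
∑-δʳ {suc n} f Fin.zero = begin
  f Fin.zero * 1ℤ + ∑ (λ k → f (Fin.suc k) * 0ℤ)
    ≡⟨ cong₂ _+_ (ℤ.*-identityʳ (f Fin.zero)) (∑-cong (ℤ.*-zeroʳ ∘ f ∘ Fin.suc)) ⟩
  f Fin.zero + ∑ {n} (λ _ → 0ℤ)  ≡⟨ cong (_+_ (f Fin.zero)) (∑-zero n) ⟩
  f Fin.zero + 0ℤ                ≡⟨ ℤ.+-identityʳ _ ⟩
  f Fin.zero                     ∎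
  where open ≡-Reasoning
∑-δʳ {suc n} f (Fin.suc a) = begin
  f Fin.zero * 0ℤ + ∑ (λ k → f (Fin.suc k) * Id (Fin.suc k) (Fin.suc a))
    ≡⟨ cong₂ _+_ (ℤ.*-zeroʳ (f Fin.zero)) (∑-cong λ k → cong (f (Fin.suc k) *_) (Id-suc k a)) ⟩
  0ℤ + ∑ (λ k → f (Fin.suc k) * Id k a)  ≡⟨ ℤ.+-identityˡ _ ⟩
  ∑ (λ k → f (Fin.suc k) * Id k a)       ≡⟨ ∑-δʳ (f ∘ Fin.suc) a ⟩
  f (Fin.suc a)                          ∎
  where open ≡-Reasoning

∑-δˡ : ∀ {n} (f : Fin n → ℤ) a → ∑ (λ k → Id a k * f k) ≡ f a
∑-δˡ f a = trans (∑-cong λ k → trans (ℤ.*-comm (Id a k) (f k)) (cong (f k *_) (Id-sym a k))) (∑-δʳ f a)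

⟨$⟩ʳ-injective : ∀ {d} (σ : Perm d) {a b} → σ ⟨$⟩ʳ a ≡ σ ⟨$⟩ʳ b → a ≡ b
⟨$⟩ʳ-injective σ {a} {b} σa≡σb = begin
  a                       ≡⟨ inverseˡ σ ⟨
  σ ⟨$⟩ˡ (σ ⟨$⟩ʳ a)       ≡⟨ cong (σ ⟨$⟩ˡ_) σa≡σb ⟩
  σ ⟨$⟩ˡ (σ ⟨$⟩ʳ b)       ≡⟨ inverseˡ σ ⟩
  b                       ∎
  where open ≡-Reasoning

Id-⟨$⟩ʳ : ∀ {d} (σ : Perm d) a b → Id (σ ⟨$⟩ʳ a) (σ ⟨$⟩ʳ b) ≡ Id a b
Id-⟨$⟩ʳ σ a b with σ ⟨$⟩ʳ a Fin.≟ σ ⟨$⟩ʳ b | a Fin.≟ b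
... | yes _     | yes _   = refl
... | no  _     | no  _   = refl
... | yes σa≡σb | no  a≢b = contradiction (⟨$⟩ʳ-injective σ σa≡σb) a≢b
... | no  σa≢σb | yes refl = contradiction refl σa≢σb

Id-⟨$⟩ʳ-adjoint : ∀ {d} (σ : Perm d) i k → Id i (σ ⟨$⟩ʳ k) ≡ Id (σ ⟨$⟩ˡ i) k
Id-⟨$⟩ʳ-adjoint σ i k = trans (sym (Id-⟨$⟩ʳ (flip σ) i (σ ⟨$⟩ʳ k))) (cong (Id (σ ⟨$⟩ˡ i)) (inverseˡ σ))

·-entry : ∀ {d} (M : Mat d) σ i j → (M · σ) i j ≡ M i (σ ⟨$⟩ʳ j)
·-entry M σ i j = ∑-δʳ (M i) (σ ⟨$⟩ʳ j)

·⁻¹-entry : ∀ {d} (M : Mat d) σ i j → (M ·⁻¹ σ) i j ≡ M i (σ ⟨$⟩ˡ j)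
·⁻¹-entry M σ i j = ∑-δʳ (M i) (σ ⟨$⟩ˡ j)

Pmat-⊗-entry : ∀ {d} σ (M : Mat d) i j → (Pmat σ ⊗ M) i j ≡ M (σ ⟨$⟩ˡ i) j
Pmat-⊗-entry σ M i j =
  trans (∑-cong λ k → cong (_* M k j) (Id-⟨$⟩ʳ-adjoint σ i k)) (∑-δˡ (λ k → M k j) (σ ⟨$⟩ˡ i))

PmatInv-⊗-entry : ∀ {d} σ (M : Mat d) i j → (PmatInv σ ⊗ M) i j ≡ M (σ ⟨$⟩ʳ i) j
PmatInv-⊗-entry σ = Pmat-⊗-entry (flip σ)

≈-setoid : ℕ → Setoid _ _
≈-setoid d = record
  { Carrier       = Mat d
  ; _≈_           = _≈_
  ; isEquivalence = record
    { refl  = λ _ _ → refl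
    ; sym   = λ X≈Y i j → sym (X≈Y i j)
    ; trans = λ X≈Y Y≈Z i j → trans (X≈Y i j) (Y≈Z i j)
    }
  }

module ≈ {d} = Setoid (≈-setoid d)
module ≈-Reasoning {d} = SetoidReasoning (≈-setoid d)

⊗-cong : ∀ {d} {M M′ N N′ : Mat d} → M ≈ M′ → N ≈ N′ → M ⊗ N ≈ M′ ⊗ N′
⊗-cong M≈M′ N≈N′ i j = ∑-cong λ k → cong₂ _*_ (M≈M′ i k) (N≈N′ k j)

⊗-congˡ : ∀ {d} (M : Mat d) {N N′ : Mat d} → N ≈ N′ → M ⊗ N ≈ M ⊗ N′
⊗-congˡ M = ⊗-cong {M = M} ≈.refl

⊗-congʳ : ∀ {d} (N : Mat d) {M M′ : Mat d} → M ≈ M′ → M ⊗ N ≈ M′ ⊗ N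
⊗-congʳ N M≈M′ = ⊗-cong {N = N} M≈M′ ≈.refl

⊗-identityˡ : ∀ {d} (M : Mat d) → Id ⊗ M ≈ M
⊗-identityˡ M i j = ∑-δˡ (λ k → M k j) i

⊗-assoc : ∀ {d} (M N P : Mat d) → (M ⊗ N) ⊗ P ≈ M ⊗ (N ⊗ P)
⊗-assoc {d} M N P i j = begin
  ∑ (λ k → (M ⊗ N) i k * P k j)
    ≡⟨ ∑≡sum {d} _ ⟩
  ℤ∑.sum (λ k → ∑ (λ l → M i l * N l k) * P k j)
    ≡⟨ ℤ∑.sum-cong-≗ {d} (λ k → cong (_* P k j) (∑≡sum {d} _)) ⟩
  ℤ∑.sum (λ k → ℤ∑.sum (λ l → M i l * N l k) * P k j)
    ≡⟨ ℤ∑.sum-cong-≗ {d} (λ k → ℤ∑.*-distribʳ-sum {d} (P k j) _) ⟩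
  ℤ∑.sum (λ k → ℤ∑.sum (λ l → M i l * N l k * P k j))
    ≡⟨ ℤ∑.∑-comm {d} {d} _ ⟩
  ℤ∑.sum (λ l → ℤ∑.sum (λ k → M i l * N l k * P k j))
    ≡⟨ ℤ∑.sum-cong-≗ {d} (λ l → ℤ∑.sum-cong-≗ {d} λ k → ℤ.*-assoc (M i l) (N l k) (P k j)) ⟩
  ℤ∑.sum (λ l → ℤ∑.sum (λ k → M i l * (N l k * P k j)))
    ≡⟨ ℤ∑.sum-cong-≗ {d} (λ l → ℤ∑.*-distribˡ-sum {d} (M i l) _) ⟨
  ℤ∑.sum (λ l → M i l * ℤ∑.sum (λ k → N l k * P k j))
    ≡⟨ ℤ∑.sum-cong-≗ {d} (λ l → cong (M i l *_) (∑≡sum {d} _)) ⟨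
  ℤ∑.sum (λ l → M i l * (N ⊗ P) l j)
    ≡⟨ ∑≡sum {d} _ ⟨
  ∑ (λ l → M i l * (N ⊗ P) l j)
    ∎
  where open ≡-Reasoning

⊗-cancel-middle : ∀ {d} {X Y : Mat d} (U W : Mat d) → X ⊗ Y ≈ Id → (U ⊗ X) ⊗ (Y ⊗ W) ≈ U ⊗ W
⊗-cancel-middle {X = X} {Y} U W XY≈Id = begin
  (U ⊗ X) ⊗ (Y ⊗ W)  ≈⟨ ⊗-assoc U X (Y ⊗ W) ⟩
  U ⊗ (X ⊗ (Y ⊗ W))  ≈⟨ ⊗-congˡ U (⊗-assoc X Y W) ⟨
  U ⊗ ((X ⊗ Y) ⊗ W)  ≈⟨ ⊗-congˡ U (⊗-congʳ W XY≈Id) ⟩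
  U ⊗ (Id ⊗ W)       ≈⟨ ⊗-congˡ U (⊗-identityˡ W) ⟩
  U ⊗ W              ∎
  where open ≈-Reasoning

GL-Id : ∀ {d} → GL (Id {d})
GL-Id = Id , ⊗-identityˡ Id , ⊗-identityˡ Id

GL-⊗ : ∀ {d} {U V : Mat d} → GL U → GL V → GL (U ⊗ V)
GL-⊗ {U = U} {V} (U⁻¹ , UU⁻¹≈Id , U⁻¹U≈Id) (V⁻¹ , VV⁻¹≈Id , V⁻¹V≈Id) =
  V⁻¹ ⊗ U⁻¹ ,
  ≈.trans (⊗-cancel-middle U U⁻¹ VV⁻¹≈Id) UU⁻¹≈Id ,
  ≈.trans (⊗-cancel-middle V⁻¹ V U⁻¹U≈Id) V⁻¹V≈Id

GL-PmatInv : ∀ {d} (σ : Perm d) → GL (PmatInv σ)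
GL-PmatInv σ = Pmat σ ,
  (λ i j → trans (PmatInv-⊗-entry σ (Pmat σ) i j) (Id-⟨$⟩ʳ σ i j)) ,
  (λ i j → trans (Pmat-⊗-entry σ (PmatInv σ) i j) (Id-⟨$⟩ʳ (flip σ) i j))

Pmat-conj : ∀ {d} (σ : Perm d) (N : Mat d) i j →
  (Pmat σ ⊗ N ⊗ PmatInv σ) i j ≡ N (σ ⟨$⟩ˡ i) (σ ⟨$⟩ˡ j)
Pmat-conj σ N i j = trans (·⁻¹-entry (Pmat σ ⊗ N) σ i j) (Pmat-⊗-entry σ N i (σ ⟨$⟩ˡ j))

infix 4 _∼_
_∼_ : ∀ {d} → Mat d → Mat d → Set
X ∼ Y = Σ (Mat _) λ U → GL U × (U ⊗ X ≈ Y)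

≈⇒∼ : ∀ {d} {X Y : Mat d} → X ≈ Y → X ∼ Y
≈⇒∼ {X = X} X≈Y = Id , GL-Id , ≈.trans (⊗-identityˡ X) X≈Y

∼-sym : ∀ {d} {X Y : Mat d} → X ∼ Y → Y ∼ X
∼-sym {X = X} {Y} (U , (U⁻¹ , UU⁻¹≈Id , U⁻¹U≈Id) , UX≈Y) = U⁻¹ , (U , U⁻¹U≈Id , UU⁻¹≈Id) , U⁻¹Y≈X
  where
  open ≈-Reasoning
  U⁻¹Y≈X : U⁻¹ ⊗ Y ≈ X
  U⁻¹Y≈X = begin
    U⁻¹ ⊗ Y        ≈⟨ ⊗-congˡ U⁻¹ UX≈Y ⟨
    U⁻¹ ⊗ (U ⊗ X)  ≈⟨ ⊗-assoc U⁻¹ U X ⟨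
    (U⁻¹ ⊗ U) ⊗ X  ≈⟨ ⊗-congʳ X U⁻¹U≈Id ⟩
    Id ⊗ X         ≈⟨ ⊗-identityˡ X ⟩
    X              ∎

∼-trans : ∀ {d} {X Y Z : Mat d} → X ∼ Y → Y ∼ Z → X ∼ Z
∼-trans {X = X} (U , U-GL , UX≈Y) (V , V-GL , VY≈Z) =
  V ⊗ U , GL-⊗ V-GL U-GL , ≈.trans (⊗-assoc V U X) (≈.trans (⊗-congˡ V UX≈Y) VY≈Z)

∼-setoid : ℕ → Setoid _ _
∼-setoid d = record
  { Carrier       = Mat d
  ; _≈_           = _∼_
  ; isEquivalence = record { refl = ≈⇒∼ ≈.refl ; sym = ∼-sym ; trans = ∼-trans }
  }

module ∼-Reasoning {d} = SetoidReasoning (∼-setoid d)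

cols : ∀ {d} → Mat d → (Fin d → Fin d) → Mat d
cols M κ i j = M i (κ j)

-- conj N σ is P_σ⁻¹ N P_σ.
conj : ∀ {d} → Mat d → Perm d → Mat d
conj N σ i j = N (σ ⟨$⟩ʳ i) (σ ⟨$⟩ʳ j)

∼-cols : ∀ {d} {X Y : Mat d} (κ : Fin d → Fin d) → X ∼ Y → cols X κ ∼ cols Y κ
∼-cols κ (U , U-GL , UX≈Y) = U , U-GL , λ i j → UX≈Y i (κ j)

∼-rows : ∀ {d} (σ : Perm d) (M : Mat d) → M ∼ (λ i j → M (σ ⟨$⟩ʳ i) j)
∼-rows σ M = PmatInv σ , GL-PmatInv σ , PmatInv-⊗-entry σ M

·-∼⇔·⁻¹-∼-conj : ∀ {d} {A B N : Mat d} {g₀ h γ σ : Perm d} → B · g₀ ∼ N →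
  (∀ x → σ ⟨$⟩ʳ x ≡ g₀ ⟨$⟩ʳ (h ⟨$⟩ʳ (γ ⟨$⟩ʳ x))) →
  A ∼ B · σ ⇔ A ·⁻¹ γ ∼ conj N h
·-∼⇔·⁻¹-∼-conj {A = A} {B} {N} {g₀} {h} {γ} {σ} Bg₀∼N σ≡g₀hγ = mk⇔ to from
  where
  Bσγ⁻¹≈Bg₀h : cols (B · σ) (γ ⟨$⟩ˡ_) ≈ cols (B · g₀) (h ⟨$⟩ʳ_)
  Bσγ⁻¹≈Bg₀h i j = begin
    (B · σ) i (γ ⟨$⟩ˡ j)                         ≡⟨ ·-entry B σ i _ ⟩
    B i (σ ⟨$⟩ʳ (γ ⟨$⟩ˡ j))                      ≡⟨ cong (B i) (σ≡g₀hγ _) ⟩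
    B i (g₀ ⟨$⟩ʳ (h ⟨$⟩ʳ (γ ⟨$⟩ʳ (γ ⟨$⟩ˡ j))))  ≡⟨ cong (λ x → B i (g₀ ⟨$⟩ʳ (h ⟨$⟩ʳ x))) (inverseʳ γ) ⟩
    B i (g₀ ⟨$⟩ʳ (h ⟨$⟩ʳ j))                     ≡⟨ ·-entry B g₀ i _ ⟨
    (B · g₀) i (h ⟨$⟩ʳ j)                        ∎
    where open ≡-Reasoning

  Bσγ⁻¹∼Nh : cols (B · σ) (γ ⟨$⟩ˡ_) ∼ conj N h
  Bσγ⁻¹∼Nh = begin
    cols (B · σ) (γ ⟨$⟩ˡ_)   ≈⟨ ≈⇒∼ Bσγ⁻¹≈Bg₀h ⟩
    cols (B · g₀) (h ⟨$⟩ʳ_)  ≈⟨ ∼-cols (h ⟨$⟩ʳ_) Bg₀∼N ⟩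
    cols N (h ⟨$⟩ʳ_)         ≈⟨ ∼-rows h _ ⟩
    conj N h                 ∎
    where open ∼-Reasoning

  to : A ∼ B · σ → A ·⁻¹ γ ∼ conj N h
  to A∼Bσ = begin
    A ·⁻¹ γ                 ≈⟨ ≈⇒∼ (·⁻¹-entry A γ) ⟩
    cols A (γ ⟨$⟩ˡ_)         ≈⟨ ∼-cols (γ ⟨$⟩ˡ_) A∼Bσ ⟩
    cols (B · σ) (γ ⟨$⟩ˡ_)   ≈⟨ Bσγ⁻¹∼Nh ⟩
    conj N h                 ∎
    where open ∼-Reasoning

  from : A ·⁻¹ γ ∼ conj N h → A ∼ B · σ
  from Aγ⁻¹∼Nh = begin
    A                                        ≈⟨ ≈⇒∼ (λ i _ → cong (A i) (inverseˡ γ)) ⟨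
    cols (cols A (γ ⟨$⟩ˡ_)) (γ ⟨$⟩ʳ_)          ≈⟨ ≈⇒∼ (λ i _ → ·⁻¹-entry A γ i _) ⟨
    cols (A ·⁻¹ γ) (γ ⟨$⟩ʳ_)                  ≈⟨ ∼-cols (γ ⟨$⟩ʳ_) Aγ⁻¹∼Nh ⟩
    cols (conj N h) (γ ⟨$⟩ʳ_)                 ≈⟨ ∼-cols (γ ⟨$⟩ʳ_) Bσγ⁻¹∼Nh ⟨
    cols (cols (B · σ) (γ ⟨$⟩ˡ_)) (γ ⟨$⟩ʳ_)   ≈⟨ ≈⇒∼ (λ i _ → cong ((B · σ) i) (inverseˡ γ)) ⟩
    B · σ                                    ∎
    where open ∼-Reasoning

sum-map-mono : ∀ {A : Set} {f g : A → ℕ} →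
  (∀ x → f x ≤ g x) → ∀ xs → sum (map f xs) ≤ sum (map g xs)
sum-map-mono f≤g []       = z≤n
sum-map-mono f≤g (x ∷ xs) = ℕ.+-mono-≤ (f≤g x) (sum-map-mono f≤g xs)

sum-map-mono-< : ∀ {A : Set} {f g : A → ℕ} {x xs} →
  (∀ x → f x ≤ g x) → x ∈ xs → f x < g x → sum (map f xs) < sum (map g xs)
sum-map-mono-< f≤g (here {xs = xs} refl) fx<gx = ℕ.+-mono-<-≤ fx<gx (sum-map-mono f≤g xs)
sum-map-mono-< f≤g (there x∈xs) fx<gx = ℕ.+-mono-≤-< (f≤g _) (sum-map-mono-< f≤g x∈xs fx<gx)

sum-map-zero : ∀ {A : Set} {f : A → ℕ} → (∀ x → f x ≡ 0) → ∀ xs → sum (map f xs) ≡ 0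
sum-map-zero f≡0 []       = refl
sum-map-zero f≡0 (x ∷ xs) = cong₂ ℕ._+_ (f≡0 x) (sum-map-zero f≡0 xs)

∃-interval : ∀ (f : ℕ → ℕ) {x} n → f 0 ≤ x → x < f n →
  Σ (Fin n) λ k → f (toℕ k) ≤ x × x < f (suc (toℕ k))
∃-interval f zero    f0≤x x<f0 = contradiction f0≤x (ℕ.<⇒≱ x<f0)
∃-interval f (suc n) f0≤x x<fn with _ ℕ.<? f 1
... | yes x<f1 = Fin.zero , f0≤x , x<f1
... | no  x≮f1 with ∃-interval (f ∘ suc) n (ℕ.≮⇒≥ x≮f1) x<fn
...   | k , fk≤x , x<fk+1 = Fin.suc k , fk≤x , x<fk+1

when-<-mono : ∀ {x k k′} y → k ≤ k′ → when (x ℕ.<? k) y ≤ when (x ℕ.<? k′) y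
when-<-mono {x} {k} {k′} y k≤k′ with x ℕ.<? k | x ℕ.<? k′
... | yes _   | yes _    = ℕ.≤-refl
... | yes x<k | no  x≮k′ = contradiction (ℕ.<-≤-trans x<k k≤k′) x≮k′
... | no  _   | _        = z≤n

when-<-suc : ∀ x {y} → 0 < y → when (x ℕ.<? x) y < when (x ℕ.<? suc x) y
when-<-suc x 0<y with x ℕ.<? x | x ℕ.<? suc x
... | yes x<x | _        = contradiction x<x (ℕ.<-irrefl refl)
... | no  _   | yes _    = 0<y
... | no  _   | no  x≮1+x = contradiction (ℕ.n<1+n x) x≮1+x

IsHNF-off-diagonal : ∀ {d} {N : Mat d} {i j} → IsHNF N → i ≢ j →
  (0ℤ ℤ.≤ N i j) × (N i j ℤ.< N j j)
IsHNF-off-diagonal {N = N} {i} {j} N-HNF i≢j with ℕ.<-cmp (toℕ i) (toℕ j)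
... | tri< i<j _ _ = proj₂ (proj₂ (N-HNF i j)) i<j
... | tri≈ _ i≡j _ = contradiction (Fin.toℕ-injective i≡j) i≢j
... | tri> _ _ j<i rewrite proj₁ (N-HNF i j) j<i = ℤ.≤-refl , proj₁ (proj₂ (N-HNF j j)) refl

last-index : ∀ {d} → Fin d → Σ (Fin d) λ L → suc (toℕ L) ≡ d
last-index {suc n} _ = fromℕ n , cong suc (Fin.toℕ-fromℕ n)

-- For N ∈ M(r, m) this characterises G(N) without reference to (r, m): the indices whose
-- diagonal entry equals that of the last index form the last block w_s.
DiagonalSymmetry : ∀ {d} → Mat d → Perm d → Set
DiagonalSymmetry {d} N σ =
  (∀ j → N (σ ⟨$⟩ʳ j) (σ ⟨$⟩ʳ j) ≡ N j j) ×
  (∀ j L → suc (toℕ L) ≡ d → N j j ≡ N L L → σ ⟨$⟩ʳ j ≡ j)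

module _ {d} (bs : BS d) where

  pre-mono : ∀ {k k′} → k ≤ k′ → pre bs k ≤ pre bs k′
  pre-mono k≤k′ = sum-map-mono (λ i → when-<-mono (m bs i) k≤k′) (allFin (s bs))

  pre-zero : pre bs 0 ≡ 0
  pre-zero = sum-map-zero (λ _ → refl) (allFin (s bs))

  pre-s : pre bs (s bs) ≡ d
  pre-s = trans (cong sum (map-cong everything-counted (allFin (s bs)))) (m-sum bs)
    where
    everything-counted : ∀ i → when (toℕ i ℕ.<? s bs) (m bs i) ≡ m bs i
    everything-counted i with toℕ i ℕ.<? s bs
    ... | yes _ = refl
    ... | no  i≮s = contradiction (Fin.toℕ<n i) i≮s

  pre-< : ∀ i → pre bs (toℕ i) < pre bs (suc (toℕ i))
  pre-< i = sum-map-mono-< (λ k → when-<-mono (m bs k) (ℕ.n≤1+n (toℕ i)))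
                           (∈-allFin i) (when-<-suc (toℕ i) (m-pos bs i))

  pre-<-d : ∀ i → pre bs (toℕ i) < d
  pre-<-d i = ℕ.<-≤-trans (pre-< i) (ℕ.≤-trans (pre-mono (Fin.toℕ<n i)) (ℕ.≤-reflexive pre-s))

  block-of : ∀ j → Σ (Fin (s bs)) (InBlock bs j)
  block-of j = ∃-interval (pre bs) (s bs) (ℕ.≤-trans (ℕ.≤-reflexive pre-zero) z≤n) j<pre-s
    where
    j<pre-s : toℕ j < pre bs (s bs)
    j<pre-s = subst (toℕ j <_) (sym pre-s) (Fin.toℕ<n j)

  InBlock-< : ∀ {i j b c} → InBlock bs i b → InBlock bs j c → toℕ b < toℕ c → toℕ i < toℕ j
  InBlock-< (_ , i<pre-b+1) (pre-c≤j , _) b<c = ℕ.<-≤-trans i<pre-b+1 (ℕ.≤-trans (pre-mono b<c) pre-c≤j)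

  InBlock-unique : ∀ {j b c} → InBlock bs j b → InBlock bs j c → b ≡ c
  InBlock-unique j∈b j∈c with ℕ.<-cmp (toℕ _) (toℕ _)
  ... | tri< b<c _ _ = contradiction (InBlock-< j∈b j∈c b<c) (ℕ.<-irrefl refl)
  ... | tri≈ _ b≡c _ = Fin.toℕ-injective b≡c
  ... | tri> _ _ c<b = contradiction (InBlock-< j∈c j∈b c<b) (ℕ.<-irrefl refl)

  last-block : ∀ {j b} → suc (toℕ j) ≡ d → InBlock bs j b → suc (toℕ b) ≡ s bs
  last-block {j} {b} j-last (_ , j<pre-b+1) with ℕ.m≤n⇒m<n∨m≡n (Fin.toℕ<n b)
  ... | inj₂ b-last = b-last
  ... | inj₁ b+1<s  = contradiction (ℕ.<-≤-trans pre-b+1<d d≤pre-b+1) (ℕ.<-irrefl refl)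
    where
    d≤pre-b+1 : d ≤ pre bs (suc (toℕ b))
    d≤pre-b+1 = subst (_≤ pre bs (suc (toℕ b))) j-last j<pre-b+1

    pre-b+1<d : pre bs (suc (toℕ b)) < d
    pre-b+1<d = subst (λ n → pre bs n < d) (Fin.toℕ-fromℕ< b+1<s) (pre-<-d (fromℕ< b+1<s))

  r-injective : ∀ {b c} → r bs b ≡ r bs c → b ≡ c
  r-injective {b} {c} rb≡rc with ℕ.<-cmp (toℕ b) (toℕ c)
  ... | tri< b<c _ _ = contradiction rb≡rc (ℕ.<⇒≢ (r-inc bs b c b<c))
  ... | tri≈ _ b≡c _ = Fin.toℕ-injective b≡c
  ... | tri> _ _ c<b = contradiction (sym rb≡rc) (ℕ.<⇒≢ (r-inc bs c b c<b))

  InM-diag : ∀ {N j b} → InM bs N → InBlock bs j b → N j j ≡ + r bs b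
  InM-diag N∈M j∈b = proj₁ (N∈M _ _ _ _ j∈b j∈b) refl refl

  InM-diag-injective : ∀ {N i j b c} → InM bs N →
    InBlock bs i b → InBlock bs j c → N i i ≡ N j j → b ≡ c
  InM-diag-injective N∈M i∈b j∈c Nii≡Njj =
    r-injective (ℤ.+-injective (trans (sym (InM-diag N∈M i∈b)) (trans Nii≡Njj (InM-diag N∈M j∈c))))

  InM-lower : ∀ {N i j} → InM bs N → toℕ j < toℕ i → N i j ≡ 0ℤ
  InM-lower {N} {i} {j} N∈M j<i with block-of i | block-of j
  ... | b , i∈b | c , j∈c with ℕ.<-cmp (toℕ b) (toℕ c) | N∈M i j b c i∈b j∈c
  ... | tri< b<c _ _ | _ = contradiction (InBlock-< i∈b j∈c b<c) (ℕ.<-asym j<i)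
  ... | tri≈ _ b≡c _ | _ , off-diagonal , _ =
    off-diagonal (Fin.toℕ-injective b≡c) (λ { refl → ℕ.<-irrefl refl j<i })
  ... | tri> _ _ c<b | _ , _ , below = below c<b

  InM-cong : ∀ {X Y} → X ≈ Y → InM bs X → InM bs Y
  InM-cong X≈Y X∈M i j b c i∈b j∈c with X∈M i j b c i∈b j∈c
  ... | diagonal , off-diagonal , below =
    (λ b≡c i≡j → trans (sym (X≈Y i j)) (diagonal b≡c i≡j)) ,
    (λ b≡c i≢j → trans (sym (X≈Y i j)) (off-diagonal b≡c i≢j)) ,
    (λ c<b → trans (sym (X≈Y i j)) (below c<b))

  Gp-InBlock : ∀ {σ j b} → Gp bs σ → InBlock bs j b → InBlock bs (σ ⟨$⟩ʳ j) b
  Gp-InBlock {σ} {j} {b} σ∈G j∈b with ℕ.m≤n⇒m<n∨m≡n (Fin.toℕ<n b) | σ∈G j b j∈b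
  ... | inj₁ b+1<s  | moves-within , _ = moves-within b+1<s
  ... | inj₂ b-last | _ , fixes = subst (λ i → InBlock bs i b) (sym (fixes b-last)) j∈b

  Gp-inverse : ∀ {σ} → Gp bs σ → Gp bs (flip σ)
  Gp-inverse {σ} σ∈G j b j∈b =
    (λ _ → σ⁻¹j∈b) , λ b-last → trans (sym (proj₂ (σ∈G _ b σ⁻¹j∈b) b-last)) (inverseʳ σ)
    where
    σ⁻¹j∈b : InBlock bs (σ ⟨$⟩ˡ j) b
    σ⁻¹j∈b with block-of (σ ⟨$⟩ˡ j)
    ... | c , σ⁻¹j∈c = subst (InBlock bs _) (InBlock-unique j∈c j∈b) σ⁻¹j∈c
      where
      j∈c : InBlock bs j c
      j∈c = subst (λ i → InBlock bs i c) (inverseʳ σ) (Gp-InBlock {σ} σ∈G σ⁻¹j∈c)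

  Gp-∘ : ∀ {σ τ} → Gp bs σ → Gp bs τ → Gp bs (σ ∘ₚ τ)
  Gp-∘ {σ} {τ} σ∈G τ∈G j b j∈b =
    (λ b+1<s → proj₁ (τ∈G _ b (proj₁ (σ∈G j b j∈b) b+1<s)) b+1<s) ,
    (λ b-last → trans (cong (τ ⟨$⟩ʳ_) (proj₂ (σ∈G j b j∈b) b-last)) (proj₂ (τ∈G j b j∈b) b-last))

  InM-conj : ∀ {N σ} → InM bs N → Gp bs σ → InM bs (conj N σ)
  InM-conj {N} {σ} N∈M σ∈G i j b c i∈b j∈c
    with N∈M _ _ b c (Gp-InBlock {σ} σ∈G i∈b) (Gp-InBlock {σ} σ∈G j∈c)
  ... | diagonal , off-diagonal , below =
    (λ b≡c i≡j → diagonal b≡c (cong (σ ⟨$⟩ʳ_) i≡j)) ,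
    (λ b≡c i≢j → off-diagonal b≡c (i≢j ∘ ⟨$⟩ʳ-injective σ)) ,
    below

  Gp⇒DiagonalSymmetry : ∀ {N σ} → InM bs N → Gp bs σ → DiagonalSymmetry N σ
  Gp⇒DiagonalSymmetry {N} {σ} N∈M σ∈G = preserves , fixes
    where
    preserves : ∀ j → N (σ ⟨$⟩ʳ j) (σ ⟨$⟩ʳ j) ≡ N j j
    preserves j with block-of j
    ... | b , j∈b = trans (InM-diag N∈M (Gp-InBlock {σ} σ∈G j∈b)) (sym (InM-diag N∈M j∈b))

    fixes : ∀ j L → suc (toℕ L) ≡ d → N j j ≡ N L L → σ ⟨$⟩ʳ j ≡ j
    fixes j L L-last Njj≡NLL with block-of j | block-of L
    ... | b , j∈b | c , L∈c with InM-diag-injective N∈M j∈b L∈c Njj≡NLL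
    ... | refl = proj₂ (σ∈G j b j∈b) (last-block L-last L∈c)

  DiagonalSymmetry⇒Gp : ∀ {N σ} → InM bs N → DiagonalSymmetry N σ → Gp bs σ
  DiagonalSymmetry⇒Gp {N} {σ} N∈M (preserves , fixes) j b j∈b = moves-within , fixes-last
    where
    moves-within : suc (toℕ b) < s bs → InBlock bs (σ ⟨$⟩ʳ j) b
    moves-within _ with block-of (σ ⟨$⟩ʳ j)
    ... | c , σj∈c = subst (InBlock bs _) (InM-diag-injective N∈M σj∈c j∈b (preserves j)) σj∈c

    fixes-last : suc (toℕ b) ≡ s bs → σ ⟨$⟩ʳ j ≡ j
    fixes-last b-last with last-index j
    ... | L , L-last with block-of L
    ... | c , L∈c with Fin.toℕ-injective (ℕ.suc-injective (trans b-last (sym (last-block L-last L∈c))))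
    ... | refl = fixes j L L-last (trans (InM-diag N∈M j∈b) (sym (InM-diag N∈M L∈c)))

  IsHNF-conj : ∀ {N σ} → IsHNF N → InM bs N → Gp bs σ → IsHNF (conj N σ)
  IsHNF-conj {N} {σ} N-HNF N∈M σ∈G i j =
    InM-lower (InM-conj {N} {σ} N∈M σ∈G) ,
    (λ { refl → proj₁ (proj₂ (N-HNF _ _)) refl }) ,
    λ i<j → IsHNF-off-diagonal N-HNF λ σi≡σj → ℕ.<-irrefl (cong toℕ (⟨$⟩ʳ-injective σ σi≡σj)) i<j

  Orb⇒conj : ∀ {N X} → Orb bs N X → Σ (Perm d) λ σ → Gp bs σ × X ≈ conj N σ
  Orb⇒conj {N} (σ , σ∈G , X≈σNσ⁻¹) =
    flip σ , Gp-inverse {σ} σ∈G , λ i j → trans (X≈σNσ⁻¹ i j) (Pmat-conj σ N i j)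

  conj⇒Orb : ∀ {N X σ} → Gp bs σ → X ≈ conj N σ → Orb bs N X
  conj⇒Orb {N} {σ = σ} σ∈G X≈Nσ =
    flip σ , Gp-inverse {σ} σ∈G , λ i j → trans (X≈Nσ i j) (sym (Pmat-conj (flip σ) N i j))

  Orb-sym : ∀ {N X} → Orb bs N X → Orb bs X N
  Orb-sym {N} N→X with Orb⇒conj N→X
  ... | σ , σ∈G , X≈Nσ = conj⇒Orb {σ = flip σ} (Gp-inverse {σ} σ∈G) λ i j →
    sym (trans (X≈Nσ _ _) (cong₂ N (inverseʳ σ) (inverseʳ σ)))

  Orb-trans : ∀ {N X Y} → Orb bs N X → Orb bs X Y → Orb bs N Y
  Orb-trans N→X X→Y with Orb⇒conj N→X | Orb⇒conj X→Y
  ... | σ , σ∈G , X≈Nσ | τ , τ∈G , Y≈Xτ =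
    conj⇒Orb {σ = τ ∘ₚ σ} (Gp-∘ {τ} {σ} τ∈G σ∈G) λ i j → trans (Y≈Xτ i j) (X≈Nσ _ _)

  InM-Orb : ∀ {N X} → InM bs N → Orb bs N X → InM bs X
  InM-Orb N∈M N→X with Orb⇒conj N→X
  ... | σ , σ∈G , X≈Nσ = InM-cong (λ i j → sym (X≈Nσ i j)) (InM-conj {σ = σ} N∈M σ∈G)

  IsMinOrb-Orb : ∀ {N X N₀} → Orb bs N X → IsMinOrb bs N N₀ → IsMinOrb bs X N₀
  IsMinOrb-Orb N→X (N→N₀ , N₀-least) =
    Orb-trans (Orb-sym N→X) N→N₀ , λ Y X→Y → N₀-least Y (Orb-trans N→X X→Y)

Gp-transfer : ∀ {d} (bs bs′ : BS d) {N σ} → InM bs N → InM bs′ N → Gp bs σ → Gp bs′ σ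
Gp-transfer bs bs′ {σ = σ} N∈M N∈M′ σ∈G =
  DiagonalSymmetry⇒Gp bs′ {σ = σ} N∈M′ (Gp⇒DiagonalSymmetry bs {σ = σ} N∈M σ∈G)

Orb-transfer : ∀ {d} (bs bs′ : BS d) {N X} → InM bs N → InM bs′ N → Orb bs N X → Orb bs′ N X
Orb-transfer bs bs′ N∈M N∈M′ (σ , σ∈G , X≈σNσ⁻¹) = σ , Gp-transfer bs bs′ {σ = σ} N∈M N∈M′ σ∈G , X≈σNσ⁻¹

GOf-Orb : ∀ {d} (bs : BS d) {N X} → InM bs N → Orb bs N X → ∀ σ → GOf X σ ⇔ GOf N σ
GOf-Orb bs {N} {X} N∈M N→X σ = mk⇔
  (λ (bs′ , X∈M′ , σ∈G′) → bs′ , InM-Orb bs′ X∈M′ (Orb-transfer bs bs′ X∈M X∈M′ X→N) , σ∈G′)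
  (λ (bs′ , N∈M′ , σ∈G′) → bs′ , InM-Orb bs′ N∈M′ (Orb-transfer bs bs′ N∈M N∈M′ N→X) , σ∈G′)
  where
  X∈M : InM bs X
  X∈M = InM-Orb bs N∈M N→X
  X→N : Orb bs X N
  X→N = Orb-sym bs N→X

RightCosetDecomp-factor : ∀ {d ℓ} {G : Perm d → Set} {g : Fin ℓ → Perm d} → RightCosetDecomp G g →
  ∀ (g₀ σ : Perm d) → Σ (Fin ℓ) λ i → Σ (Perm d) λ h → G h ×
    (∀ x → σ ⟨$⟩ʳ x ≡ g₀ ⟨$⟩ʳ (h ⟨$⟩ʳ (g i ⟨$⟩ʳ x)))
RightCosetDecomp-factor (cover , _) g₀ σ with cover (σ ∘ₚ flip g₀)
... | i , h , h∈G , g₀⁻¹σ≡hgᵢ =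
  i , h , h∈G , λ x → trans (sym (inverseʳ g₀ {σ ⟨$⟩ʳ x})) (cong (g₀ ⟨$⟩ʳ_) (g₀⁻¹σ≡hgᵢ x))

·⁻¹-∼-Orb⇒≃UP : ∀ {d} (bs : BS d) {A B N H : Mat d} {g₀ γ : Perm d} →
  B · g₀ ∼ N → A ·⁻¹ γ ∼ H → Orb bs N H → A ≃UP B
·⁻¹-∼-Orb⇒≃UP bs {A} {B} {N} {H} {g₀} {γ} Bg₀∼N Aγ⁻¹∼H N→H =
  let k , _ , H≈Nk = Orb⇒conj bs {N} {H} N→H
      σ = γ ∘ₚ k ∘ₚ g₀
      Aγ⁻¹∼Nk = ∼-trans {X = A ·⁻¹ γ} {H} {conj N k} Aγ⁻¹∼H (≈⇒∼ {X = H} {conj N k} H≈Nk)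
      U , U-GL , UA≈Bσ =
        Equivalence.from (·-∼⇔·⁻¹-∼-conj {A = A} {B} {N} {g₀} {k} {γ} {σ} Bg₀∼N (λ _ → refl)) Aγ⁻¹∼Nk
  in U , σ , U-GL , UA≈Bσ

theorem3p9 : (d : ℕ) (A B : Mat d) → Nonsingular A → Nonsingular B →
    (N₀ : Mat d) → InPH B N₀ →
    (ℓ : ℕ) (g : Fin ℓ → Perm d) → RightCosetDecomp (GOf N₀) g →
    ((A ≃UP B) ⇔ (Σ (Fin ℓ) λ i → Σ (Mat d) λ H → IsHNFOf (A ·⁻¹ g i) H × OOf N₀ H)) ×
    ((Σ (Fin ℓ) λ i → Σ (Mat d) λ H → IsHNFOf (A ·⁻¹ g i) H × OOf N₀ H) ⇔
     (Σ (Fin ℓ) λ i → Σ (Mat d) λ H → IsHNFOf (A ·⁻¹ g i) H ×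
        (∀ σ → GOf H σ ⇔ GOf N₀ σ) × MinOOf H N₀))
theorem3p9 d A B _ _ N₀ ((g₀ , N₀-HNF , Bg₀∼N₀) , bs₀ , N₀∈M₀ , _ , N₀-min) ℓ g decomp =
  mk⇔ UP⇒orbit orbit⇒UP , mk⇔ orbit⇒min min⇒orbit
  where
  HNF-in-orbit HNF-with-min : Set
  HNF-in-orbit = Σ (Fin ℓ) λ i → Σ (Mat d) λ H → IsHNFOf (A ·⁻¹ g i) H × OOf N₀ H
  HNF-with-min = Σ (Fin ℓ) λ i → Σ (Mat d) λ H → IsHNFOf (A ·⁻¹ g i) H ×
                   (∀ σ → GOf H σ ⇔ GOf N₀ σ) × MinOOf H N₀

  UP⇒orbit : A ≃UP B → HNF-in-orbit
  UP⇒orbit (U , σ , U-GL , UA≈Bσ) with RightCosetDecomp-factor {G = GOf N₀} {g} decomp g₀ σ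
  ... | i , h , (bs , N₀∈M , h∈G) , σ≡g₀hgᵢ = i , conj N₀ h , (H-HNF , Agᵢ⁻¹∼H) , bs , N₀∈M , N₀→H
    where
    H-HNF  = IsHNF-conj bs {N₀} {h} N₀-HNF N₀∈M h∈G
    Agᵢ⁻¹∼H = Equivalence.to (·-∼⇔·⁻¹-∼-conj {A = A} {B} {N₀} {g₀} {h} {g i} {σ} Bg₀∼N₀ σ≡g₀hgᵢ)
                            (U , U-GL , UA≈Bσ)
    N₀→H   = conj⇒Orb bs {σ = h} h∈G ≈.refl

  orbit⇒UP : HNF-in-orbit → A ≃UP B
  orbit⇒UP (i , H , (_ , Agᵢ⁻¹∼H) , bs , _ , N₀→H) =
    ·⁻¹-∼-Orb⇒≃UP bs {A} {B} {N₀} {H} {g₀} {g i} Bg₀∼N₀ Agᵢ⁻¹∼H N₀→H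

  orbit⇒min : HNF-in-orbit → HNF-with-min
  orbit⇒min (i , H , H-HNF , bs , N₀∈M , N₀→H) =
    i , H , H-HNF , GOf-Orb bs N₀∈M N₀→H , bs₀ , InM-Orb bs₀ N₀∈M₀ N₀→₀H , IsMinOrb-Orb bs₀ N₀→₀H N₀-min
    where N₀→₀H = Orb-transfer bs bs₀ N₀∈M N₀∈M₀ N₀→H

  min⇒orbit : HNF-with-min → HNF-in-orbit
  min⇒orbit (i , H , H-HNF , _ , bs , H∈M , H→N₀ , _) =
    i , H , H-HNF , bs , InM-Orb bs H∈M H→N₀ , Orb-sym bs H→N₀
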